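{- If predicate $P$ is well-moded with respect to mode interpretations $\mathit{MI}_1$ and $\mathit{MI}_2$, then it is well-moded with respect to $M = \mathit{MI}_1 \sqcap \mathit{MI}_2$.
   Context: Programs are pure logic programs in which each predicate has a single definition $(H, \exists W[C_1 \lor \cdots \lor C_k])$, with $H$ in most general form, each $C_j$ a conjunction of literals and $W$ the local variables; a head grounding is an instance with all head variables (but not local variables) replaced so that the head is ground. Truth values are Belnap's $\mathbf{4} = \{\mathbf{u},\mathbf{f},\mathbf{t},\mathbf{i}\}$ with information ordering $\mathbf{u} \sqsubseteq \mathbf{f},\mathbf{t} \sqsubseteq \mathbf{i}$; $\sqcap$ is the meet in the information ordering, extended pointwise to interpretations. An interpretation $I$ is a $\sqsupseteq^{\mathbf{4}}$-model if for every head grounding $(H,B)$, $I(H) \sqsupseteq I(B)$; the meet of two $\sqsupseteq^{\mathbf{4}}$-models is again a $\sqsupseteq^{\mathbf{4}}$-model. The mode interpretation $\mathit{MI}(P,m)$ for a mode $m$ (assignment of input/output to argument positions) maps a ground atom to $\mathbf{u}$ if its predicate is error/1, otherwise to $\mathbf{t}$ if all arguments are well typed, $\mathbf{i}$ if some input argument is ill-typed, and $\mathbf{f}$ if all inputs are well typed but some output is ill-typed; for a mode group $\{m_1,\ldots,m_k\}$ it is the pointwise meet $\mathit{MI}(P,m_1) \sqcap \cdots \sqcap \mathit{MI}(P,m_k)$. A definition is well-moded with respect to mode interpretation $M$ if $M$ is a $\sqsupseteq^{\mathbf{4}}$-model and, for each head grounding $(H,\exists W[C_1 \lor \cdots \lor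 C_k])$ with $M(H) = \mathbf{t}$, $M(\exists W\, C_j) \neq \mathbf{i}$ for all $j$. -}

module Defs where

open import Data.Nat using (ℕ; _<?_)
open import Data.Fin using (Fin; fromℕ<)
open import Data.Vec using (Vec; []; _∷_; lookup)
open import Data.List using (List; []; _∷_; allFin)
open import Data.Bool.ListAction using (any)
open import Data.List.NonEmpty using (List⁺; _∷_)
open import Data.List.Relation.Unary.All using (All)
open import Data.List.Relation.Unary.Any using (Any)
open import Data.List.Membership.Propositional using (_∈_)
open import Data.Bool using (Bool; true; false; if_then_else_; _∧_; not)
open import Data.Maybe using (Maybe; just)
open import Data.Product using (Σ; _×_)
open import Data.Unit using (⊤)
open import Data.Empty using (⊥)
open import Relation.Nullary using (¬_; yes; no)
open import Relation.Binary.PropositionalEquality using (_≡_)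
open import Relation.Binary.Definitions using (DecidableEquality)

-- Belnap's four truth values

data Four : Set where
  u f t i : Four

-- meet in the information ordering  u ⊑ f,t ⊑ i
_⊓_ : Four → Four → Four
u ⊓ _ = u
i ⊓ y = y
f ⊓ u = u
f ⊓ f = f
f ⊓ t = u
f ⊓ i = f
t ⊓ u = u
t ⊓ f = u
t ⊓ t = t
t ⊓ i = t

-- Bilattice components: "told true" / "told false"
-- (u = (no,no), t = (yes,no), f = (no,yes), i = (yes,yes)).
-- Values of (possibly infinitely quantified) formulas are given by these
-- two components as propositions; Belnap's value of a formula is the
-- element of 4 whose components are these propositions.
record Val : Set₁ where
  field
    tr : Set
    fa : Set
open Val public

⟦_⟧4 : Four → Val
⟦ u ⟧4 = record { tr = ⊥ ; fa = ⊥ }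
⟦ f ⟧4 = record { tr = ⊥ ; fa = ⊤ }
⟦ t ⟧4 = record { tr = ⊤ ; fa = ⊥ }
⟦ i ⟧4 = record { tr = ⊤ ; fa = ⊤ }

_⊒_ : Val → Val → Set
x ⊒ y = (tr y → tr x) × (fa y → fa x)

NotI : Val → Set
NotI v = ¬ (tr v × fa v)

record Sig : Set₁ where
  field
    FunSym    : Set
    funArity  : FunSym → ℕ
    PredSym   : Set
    predArity : PredSym → ℕ
    _≟P_      : DecidableEquality PredSym
    errorP    : PredSym
    errorArity : predArity errorP ≡ 1

module Lang (S : Sig) where
  open Sig S public

  data Term : Set where
    var : ℕ → Term
    fn  : (g : FunSym) → Vec Term (funArity g) → Term

  data GTerm : Set where
    gfn : (g : FunSym) → Vec GTerm (funArity g) → GTerm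

  Env : Set
  Env = ℕ → GTerm

  mutual
    inst : Env → Term → GTerm
    inst σ (var x)   = σ x
    inst σ (fn g ts) = gfn g (insts σ ts)

    insts : ∀ {n} → Env → Vec Term n → Vec GTerm n
    insts σ []       = []
    insts σ (s ∷ ts) = inst σ s ∷ insts σ ts

  data Atom : Set where
    app : (p : PredSym) → Vec Term (predArity p) → Atom
    _≐_ : Term → Term → Atom

  data Literal : Set where
    pos : Atom → Literal
    neg : Atom → Literal

  Conj : Set
  Conj = List Literal

  -- A definition of p with arity n: head p(X₀,…,Xₙ₋₁) in most general form
  -- (head variables are var 0 … var (n-1)); body  ∃W[C₁ ∨ ⋯ ∨ Cₖ]
  -- given as the list of conjunctions; W = all other variables.
  Body : Set
  Body = List Conj

  Program : Set
  Program = (p : PredSym) → Maybe Body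

  Interp : Set
  Interp = (p : PredSym) → Vec GTerm (predArity p) → Four

  _⊓I_ : Interp → Interp → Interp
  (I ⊓I J) p as = I p as ⊓ J p as

  env : ∀ {n} → Vec GTerm n → Env → Env
  env {n} args w x with x <? n
  ... | yes x<n = lookup args (fromℕ< x<n)
  ... | no _    = w x

  valAtom : Interp → Env → Atom → Val
  valAtom I σ (app p ts) = ⟦ I p (insts σ ts) ⟧4
  valAtom I σ (s ≐ r) = record { tr = inst σ s ≡ inst σ r ; fa = ¬ (inst σ s ≡ inst σ r) }

  valLit : Interp → Env → Literal → Val
  valLit I σ (pos a) = valAtom I σ a
  valLit I σ (neg a) = record { tr = fa (valAtom I σ a) ; fa = tr (valAtom I σ a) }

  valConj : Interp → Env → Conj → Val
  valConj I σ C = record { tr = All (λ L → tr (valLit I σ L)) C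
                         ; fa = Any (λ L → fa (valLit I σ L)) C }

  valEx : ∀ {n} → Interp → Vec GTerm n → Conj → Val
  valEx I args C = record { tr = Σ Env (λ w → tr (valConj I (env args w) C))
                          ; fa = (w : Env) → fa (valConj I (env args w) C) }

  valBody : ∀ {n} → Interp → Vec GTerm n → Body → Val
  valBody I args B = record { tr = Σ Env (λ w → Any (λ C → tr (valConj I (env args w) C)) B)
                            ; fa = (w : Env) → All (λ C → fa (valConj I (env args w) C)) B }

  IsModel : Program → Interp → Set
  IsModel prog I = ∀ p (B : Body) → prog p ≡ just B →
                   ∀ (args : Vec GTerm (predArity p)) → ⟦ I p args ⟧4 ⊒ valBody I args B

  WellModed : Program → PredSym → Interp → Set
  WellModed prog P M =
    IsModel prog M ×
    (∀ (B : Body) → prog P ≡ just B → ∀ (args : Vec GTerm (predArity P)) →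
       M P args ≡ t → ∀ C → C ∈ B → NotI (valEx M args C))

  -- well-typedness of a ground term in each argument position
  Typing : Set
  Typing = (p : PredSym) → Fin (predArity p) → GTerm → Bool

  data InOut : Set where
    In Out : InOut

  isIn : InOut → Bool
  isIn In  = true
  isIn Out = false

  isOut : InOut → Bool
  isOut io = not (isIn io)

  Mode : Set
  Mode = (p : PredSym) → Fin (predArity p) → InOut

  MI : Typing → Mode → Interp
  MI ty m p args with p ≟P errorP
  ... | yes _ = u
  ... | no _  =
    if any (λ k → isIn (m p k) ∧ not (ty p k (lookup args k))) (allFin (predArity p))
    then i
    else (if any (λ k → isOut (m p k) ∧ not (ty p k (lookup args k))) (allFin (predArity p))
          then f else t)

  MIs : Typing → Mode → List Mode → Interp
  MIs ty m []        = MI ty m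
  MIs ty m (m' ∷ ms) = MI ty m ⊓I MIs ty m' ms

  MIgroup : Typing → List⁺ Mode → Interp
  MIgroup ty (m ∷ ms) = MIs ty m ms

-- The meet M₁ ⊓ M₂ lies below M₁ and M₂ in the information ordering, and the value of
-- every literal, conjunction and body is monotone in the interpretation. So each head
-- value Mₖ(H) dominates Mₖ(B) ⊒ M(B), and the greatest lower bound M(H) of the two
-- still dominates M(B). For the mode condition, a ⊓ b = t forces a = t or b = t:
-- a head that is t under M is t under some Mₖ, whose well-modedness rules out the
-- value i for each ∃W Cⱼ, and that value can only lose information under M.
module Submission where

open import Defs
open import Data.List.Membership.Propositional using (_∈_)
open import Data.List.NonEmpty using (List⁺)
open import Data.List.Relation.Unary.All as All using ()
open import Data.List.Relation.Unary.Any as Any using ()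
open import Data.Product using (_,_; proj₁; proj₂; map; map₂; swap)
open import Data.Sum using (_⊎_; inj₁; inj₂)
open import Data.Maybe using (just)
open import Data.Unit using (tt)
open import Data.Vec using (Vec)
open import Relation.Binary.PropositionalEquality using (_≡_; refl)

⊒-trans : ∀ {u v w} → u ⊒ v → v ⊒ w → u ⊒ w
⊒-trans (tr₁ , fa₁) (tr₂ , fa₂) = (λ x → tr₁ (tr₂ x)) , (λ x → fa₁ (fa₂ x))

NotI-antitone : ∀ {v w} → v ⊒ w → NotI v → NotI w
NotI-antitone v⊒w ¬i w-both = ¬i (map (proj₁ v⊒w) (proj₂ v⊒w) w-both)

⊓-lowerˡ : ∀ a b → ⟦ a ⟧4 ⊒ ⟦ a ⊓ b ⟧4
⊓-lowerˡ u _ = (λ ()) , (λ ())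
⊓-lowerˡ i _ = (λ _ → tt) , (λ _ → tt)
⊓-lowerˡ f u = (λ ()) , (λ ())
⊓-lowerˡ f f = (λ ()) , (λ _ → tt)
⊓-lowerˡ f t = (λ ()) , (λ ())
⊓-lowerˡ f i = (λ ()) , (λ _ → tt)
⊓-lowerˡ t u = (λ ()) , (λ ())
⊓-lowerˡ t f = (λ ()) , (λ ())
⊓-lowerˡ t t = (λ _ → tt) , (λ ())
⊓-lowerˡ t i = (λ _ → tt) , (λ ())

⊓-lowerʳ : ∀ a b → ⟦ b ⟧4 ⊒ ⟦ a ⊓ b ⟧4
⊓-lowerʳ u _ = (λ ()) , (λ ())
⊓-lowerʳ i _ = (λ x → x) , (λ x → x)
⊓-lowerʳ f u = (λ ()) , (λ ())
⊓-lowerʳ f f = (λ ()) , (λ _ → tt)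
⊓-lowerʳ f t = (λ ()) , (λ ())
⊓-lowerʳ f i = (λ ()) , (λ _ → tt)
⊓-lowerʳ t u = (λ ()) , (λ ())
⊓-lowerʳ t f = (λ ()) , (λ ())
⊓-lowerʳ t t = (λ _ → tt) , (λ ())
⊓-lowerʳ t i = (λ _ → tt) , (λ ())

⊓-tr : ∀ a b → tr ⟦ a ⟧4 → tr ⟦ b ⟧4 → tr ⟦ a ⊓ b ⟧4
⊓-tr t t _ _ = tt
⊓-tr t i _ _ = tt
⊓-tr i t _ _ = tt
⊓-tr i i _ _ = tt

⊓-fa : ∀ a b → fa ⟦ a ⟧4 → fa ⟦ b ⟧4 → fa ⟦ a ⊓ b ⟧4
⊓-fa f f _ _ = tt
⊓-fa f i _ _ = tt
⊓-fa i f _ _ = tt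
⊓-fa i i _ _ = tt

⊓-greatest : ∀ a b {v} → ⟦ a ⟧4 ⊒ v → ⟦ b ⟧4 ⊒ v → ⟦ a ⊓ b ⟧4 ⊒ v
⊓-greatest a b (trᵃ , faᵃ) (trᵇ , faᵇ) =
  (λ x → ⊓-tr a b (trᵃ x) (trᵇ x)) , (λ x → ⊓-fa a b (faᵃ x) (faᵇ x))

⊓≡t⇒≡t : ∀ a b → a ⊓ b ≡ t → a ≡ t ⊎ b ≡ t
⊓≡t⇒≡t t t _ = inj₁ refl
⊓≡t⇒≡t t i _ = inj₁ refl
⊓≡t⇒≡t i t _ = inj₂ refl
⊓≡t⇒≡t u _ ()
⊓≡t⇒≡t f u ()
⊓≡t⇒≡t f f ()
⊓≡t⇒≡t f t ()
⊓≡t⇒≡t f i ()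
⊓≡t⇒≡t t u ()
⊓≡t⇒≡t t f ()
⊓≡t⇒≡t i u ()
⊓≡t⇒≡t i f ()
⊓≡t⇒≡t i i ()

module _ (S : Sig) where
  open Lang S

  _⊒I_ : Interp → Interp → Set
  I ⊒I J = ∀ p as → ⟦ I p as ⟧4 ⊒ ⟦ J p as ⟧4

  ⊓I-lowerˡ : ∀ I J → I ⊒I (I ⊓I J)
  ⊓I-lowerˡ I J p as = ⊓-lowerˡ (I p as) (J p as)

  ⊓I-lowerʳ : ∀ I J → J ⊒I (I ⊓I J)
  ⊓I-lowerʳ I J p as = ⊓-lowerʳ (I p as) (J p as)

  module _ {I J : Interp} (I⊒J : I ⊒I J) where

    valAtom-mono : ∀ σ a → valAtom I σ a ⊒ valAtom J σ a
    valAtom-mono σ (app p ts) = I⊒J p (insts σ ts)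
    valAtom-mono σ (s ≐ r)    = (λ x → x) , (λ x → x)

    valLit-mono : ∀ σ L → valLit I σ L ⊒ valLit J σ L
    valLit-mono σ (pos a) = valAtom-mono σ a
    valLit-mono σ (neg a) = swap (valAtom-mono σ a)

    valConj-mono : ∀ σ C → valConj I σ C ⊒ valConj J σ C
    valConj-mono σ C =
      All.map (λ {L} → proj₁ (valLit-mono σ L)) , Any.map (λ {L} → proj₂ (valLit-mono σ L))

    valEx-mono : ∀ {n} (args : Vec GTerm n) C → valEx I args C ⊒ valEx J args C
    valEx-mono args C =
      map₂ (λ {w} → proj₁ (valConj-mono (env args w) C)) ,
      (λ all-fa w → proj₂ (valConj-mono (env args w) C) (all-fa w))

    valBody-mono : ∀ {n} (args : Vec GTerm n) B → valBody I args B ⊒ valBody J args B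
    valBody-mono args B =
      map₂ (λ {w} → Any.map (λ {C} → proj₁ (valConj-mono (env args w) C))) ,
      (λ all-fa w → All.map (λ {C} → proj₂ (valConj-mono (env args w) C)) (all-fa w))

  IsModel-⊓ : ∀ {prog I J} → IsModel prog I → IsModel prog J → IsModel prog (I ⊓I J)
  IsModel-⊓ {I = I} {J} modelᴵ modelᴶ p B def args =
    ⊓-greatest (I p args) (J p args)
      (⊒-trans (modelᴵ p B def args) (valBody-mono (⊓I-lowerˡ I J) args B))
      (⊒-trans (modelᴶ p B def args) (valBody-mono (⊓I-lowerʳ I J) args B))

  WellModed-⊓ : ∀ {prog P I J} → WellModed prog P I → WellModed prog P J →
                WellModed prog P (I ⊓I J)
  WellModed-⊓ {prog} {P} {I} {J} (modelᴵ , modedᴵ) (modelᴶ , modedᴶ) =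
    IsModel-⊓ modelᴵ modelᴶ , moded
    where
    moded : ∀ B → prog P ≡ just B → ∀ args → (I ⊓I J) P args ≡ t →
            ∀ C → C ∈ B → NotI (valEx (I ⊓I J) args C)
    moded B def args headᵗ C C∈B with ⊓≡t⇒≡t (I P args) (J P args) headᵗ
    ... | inj₁ Iᵗ = NotI-antitone (valEx-mono (⊓I-lowerˡ I J) args C) (modedᴵ B def args Iᵗ C C∈B)
    ... | inj₂ Jᵗ = NotI-antitone (valEx-mono (⊓I-lowerʳ I J) args C) (modedᴶ B def args Jᵗ C C∈B)

-- Nothing specific to mode interpretations is needed: WellModed-⊓ holds for any two interpretations.
proposition9p7 : (S : Sig) → let open Lang S in
    (ty : Typing) (prog : Program) (P : PredSym) (g₁ g₂ : List⁺ Mode) →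
    WellModed prog P (MIgroup ty g₁) →
    WellModed prog P (MIgroup ty g₂) →
    WellModed prog P (MIgroup ty g₁ ⊓I MIgroup ty g₂)
proposition9p7 S ty prog P g₁ g₂ = WellModed-⊓ S
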